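{- Let $\mathcal{C}$ be a caterpillar graph whose vertices $0,1,\dots,n$ form a path of maximum length (edges $\{t,t+1\}$), all other vertices being pendant vertices adjacent to path vertices. Let $X=\{\{0,\alpha\}:\alpha\neq 0\}\cup\{\{\alpha,n\}:\deg(\alpha)\neq1\}$. Let $\{k,j\}\notin X$ with $0<k\le n$ and $j>n$ (so $j$ is not on the path), let $i$ be the path vertex adjacent to $j$, and suppose $k<i$. Then for every $2$-element subset $Y$ of the vertex set of $\mathcal{C}$, \[d_{\mathcal{C}}(Y\cup\{k,j\})=d_{\mathcal{C}}(Y\cup\{0,j\})-d_{\mathcal{C}}(Y\cup\{0,n\})+d_{\mathcal{C}}(Y\cup\{k,n\}),\] i.e. the column of $D_2(\mathcal{C})$ indexed by $\{k,j\}$ equals the column indexed by $\{0,j\}$ minus the column indexed by $\{0,n\}$ plus the column indexed by $\{k,n\}$.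
   Context: A caterpillar graph is a tree in which every vertex is within distance $1$ of a central path. The vertices not on the path are labelled by integers greater than $n$. For a connected graph $G$ and a vertex set $Y$ with $|Y|\ge 2$, the Steiner distance $d_G(Y)$ is the minimum number of edges among all connected subgraphs of $G$ whose vertex set contains $Y$. The $2$-Steiner distance matrix $D_2(G)$ has rows and columns indexed by $2$-element vertex subsets, with $(X_1,X_2)$-entry $d_G(X_1\cup X_2)$. -}

module Defs where

open import Data.Nat using (ℕ; zero; suc; _+_; _≤_; _<_)
open import Data.Nat.Properties using (_≟_)
open import Data.Fin using (Fin; toℕ; splitAt)
open import Data.Fin.Subset using (Subset; ∣_∣) renaming (_∈_ to _∈ₛ_)
open import Data.List using (List; []; _∷_; length; filter; allFin)
open import Data.List.Membership.Propositional using (_∈_)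
open import Data.List.Relation.Unary.All using (All)
open import Data.List.Relation.Unary.Linked using (Linked)
open import Data.List.Relation.Unary.Unique.Propositional using (Unique)
open import Data.Product using (_×_; _,_; proj₁; proj₂; ∃)
open import Data.Sum using (_⊎_; [_,_])
open import Relation.Nullary using (¬_)
open import Relation.Nullary.Decidable using (_⊎-dec_)
open import Relation.Binary.PropositionalEquality using (_≡_)

-- A caterpillar with central path 0,1,…,n (edges {t,t+1}, t < n) and
-- m pendant vertices labelled n+1, …, n+m; pendant vertex n+1+p is
-- adjacent to the path vertex att p.  Vertex set = {0,…,n+m}.
record Caterpillar : Set where
  field
    n       : ℕ
    m       : ℕ
    att     : Fin m → ℕ
    att≤n   : ∀ p → att p ≤ n

module _ (G : Caterpillar) where
  open Caterpillar G

  IsVertex : ℕ → Set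
  IsVertex v = v ≤ n + m

  -- Edges are indexed by Fin (n + m): the first n are the path edges
  -- {t , t+1}, the remaining m the pendant edges {att p , n+1+p}.
  Edge : Set
  Edge = Fin (n + m)

  ends : Edge → ℕ × ℕ
  ends e = [ (λ t → toℕ t , suc (toℕ t)) , (λ p → att p , suc (n + toℕ p)) ] (splitAt n e)

  Joins : Edge → ℕ → ℕ → Set
  Joins e u w = (proj₁ (ends e) ≡ u × proj₂ (ends e) ≡ w)
              ⊎ (proj₁ (ends e) ≡ w × proj₂ (ends e) ≡ u)

  Adj : ℕ → ℕ → Set
  Adj u w = ∃ λ e → Joins e u w

  deg : ℕ → ℕ
  deg v = length (filter (λ e → (proj₁ (ends e) ≟ v) ⊎-dec (proj₂ (ends e) ≟ v)) (allFin (n + m)))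

  IsPath : List ℕ → Set
  IsPath ps = Unique ps × Linked Adj ps

  MaxPath : Set
  MaxPath = ∀ ps → IsPath ps → length ps ≤ suc n

  InX : ℕ → ℕ → Set
  InX a b = (a ≡ 0 × ¬ b ≡ 0) ⊎ (b ≡ 0 × ¬ a ≡ 0)
          ⊎ (b ≡ n × ¬ a ≡ n × ¬ deg a ≡ 1) ⊎ (a ≡ n × ¬ b ≡ n × ¬ deg b ≡ 1)

  data Walk (F : Subset (n + m)) : ℕ → ℕ → Set where
    []  : ∀ {u} → Walk F u u
    _∷_ : ∀ {u w v} → (∃ λ e → e ∈ₛ F × Joins e u w) → Walk F w v → Walk F u v

  record ConnSubgraph : Set where
    field
      S        : List ℕ
      F        : Subset (n + m)
      S-vert   : All IsVertex S
      F-ends   : ∀ e → e ∈ₛ F → proj₁ (ends e) ∈ S × proj₂ (ends e) ∈ S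
      conn     : ∀ {u v} → u ∈ S → v ∈ S → Walk F u v

  size : ConnSubgraph → ℕ
  size H = ∣ ConnSubgraph.F H ∣

  Contains : ConnSubgraph → List ℕ → Set
  Contains H Y = All (λ y → y ∈ ConnSubgraph.S H) Y

  IsSteinerDist : List ℕ → ℕ → Set
  IsSteinerDist Y d = (∃ λ H → Contains H Y × size H ≡ d)
                    × (∀ H → Contains H Y → d ≤ size H)

-- Every vertex has a foot on the path 0,1,…,n (itself, or the path vertex a
-- pendant vertex hangs from).  For a vertex list Y with two distinct members,
-- a minimum connected subgraph containing Y consists exactly of the path
-- edges between the smallest and the largest foot of Y together with the
-- pendant edges of the pendant vertices in Y: any connected subgraph
-- containing Y must cross every such path edge and leave every such pendant
-- vertex.  Hence d(Y) is an interval length plus a count of pendant vertices.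
-- In the four Steiner distances of the theorem the pendant counts agree in
-- pairs, and the four foot intervals [L,H), [0,n), [0,H), [L,n) satisfy
-- [L,H) + [0,n) = [0,H) + [L,n) as multisets.
module Submission where

open import Defs
open import Data.Nat using (ℕ; _+_; _≤_; _<_)
open import Data.Integer using (ℤ; +_; _-_) renaming (_+_ to _+ℤ_)
open import Data.List using (List; []; _∷_)
open import Relation.Nullary using (¬_)
open import Relation.Binary.PropositionalEquality using (_≡_)

open import Data.Bool using (Bool; true; false; T; if_then_else_)
open import Data.Bool.Properties using (T-≡)
open import Data.Fin as Fin using (Fin; toℕ; fromℕ<; splitAt; _↑ˡ_; _↑ʳ_)
open import Data.Fin.Properties using (toℕ<n; toℕ-fromℕ<; toℕ-injective;
  splitAt-↑ˡ; splitAt-↑ʳ; splitAt⁻¹-↑ˡ; splitAt⁻¹-↑ʳ)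
open import Data.Fin.Subset using (Subset; ∣_∣; _⊆_) renaming (_∈_ to _∈ₛ_)
open import Data.Fin.Subset.Properties using (p⊆q⇒∣p∣≤∣q∣)
open import Data.Integer.Properties using (pos-+)
open import Data.Integer.Tactic.RingSolver using (solve-∀)
open import Data.List using (_++_; foldr; applyUpTo)
open import Data.List.Membership.DecPropositional Data.Nat._≟_ using (_∈_; _∈?_)
open import Data.List.Membership.Propositional.Properties
  using (∈-++⁺ˡ; ∈-++⁺ʳ; ∈-++⁻; ∈-applyUpTo⁺; ∈-applyUpTo⁻)
open import Data.List.Relation.Unary.All as All using (All)
open import Data.List.Relation.Unary.Any using (here; there)
open import Data.Nat using (zero; suc; _∸_; _⊓_; _⊔_; z≤n; s≤s; s≤s⁻¹; _≤?_; _<?_)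
open import Data.Nat.Properties
open import Algebra.Properties.CommutativeSemigroup +-commutativeSemigroup using (interchange)
open import Data.Product using (_×_; _,_; ∃; proj₁; proj₂)
open import Data.Sum using (_⊎_; inj₁; inj₂; [_,_])
open import Data.Vec using (tabulate)
open import Data.Vec.Properties using (lookup∘tabulate; []=⇒lookup; lookup⇒[]=)
open import Function using (_∘_; _⇔_; mk⇔; Equivalence)
open import Relation.Nullary using (Dec; yes; no; contradiction)
open import Relation.Nullary.Decidable using (⌊_⌋; _×-dec_; toWitness; fromWitness;
  isYes≗does; does-⇔)
open import Relation.Binary.PropositionalEquality
  using (_≢_; refl; sym; trans; cong; cong₂; subst; subst₂; module ≡-Reasoning)
open ≡-Reasoning

indicator : Bool → ℕ
indicator b = if b then 1 else 0

∣x∷p∣≡indicator[x]+∣p∣ : ∀ {N} x (p : Subset N) → ∣ x Data.Vec.∷ p ∣ ≡ indicator x + ∣ p ∣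
∣x∷p∣≡indicator[x]+∣p∣ true  p = refl
∣x∷p∣≡indicator[x]+∣p∣ false p = refl

∣tabulate∣-+-pointwise : ∀ {N} (f g h k : Fin N → Bool) →
  (∀ i → indicator (f i) + indicator (g i) ≡ indicator (h i) + indicator (k i)) →
  ∣ tabulate f ∣ + ∣ tabulate g ∣ ≡ ∣ tabulate h ∣ + ∣ tabulate k ∣
∣tabulate∣-+-pointwise {zero}  _ _ _ _ _ = refl
∣tabulate∣-+-pointwise {suc N} f g h k pointwise = begin
  ∣ tabulate f ∣ + ∣ tabulate g ∣                        ≡⟨ cong₂ _+_ (split f) (split g) ⟩
  (head f + ∣ tail f ∣) + (head g + ∣ tail g ∣)          ≡⟨ interchange (head f) (∣ tail f ∣) (head g) (∣ tail g ∣) ⟩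
  (head f + head g) + (∣ tail f ∣ + ∣ tail g ∣)          ≡⟨ cong₂ _+_ (pointwise Fin.zero) tails ⟩
  (head h + head k) + (∣ tail h ∣ + ∣ tail k ∣)          ≡⟨ interchange (head h) (∣ tail h ∣) (head k) (∣ tail k ∣) ⟨
  (head h + ∣ tail h ∣) + (head k + ∣ tail k ∣)          ≡⟨ cong₂ _+_ (split h) (split k) ⟨
  ∣ tabulate h ∣ + ∣ tabulate k ∣                        ∎
  where
  head : (Fin (suc N) → Bool) → ℕ
  head f = indicator (f Fin.zero)
  tail : (Fin (suc N) → Bool) → Subset N
  tail f = tabulate (f ∘ Fin.suc)
  split : ∀ f → ∣ tabulate f ∣ ≡ head f + ∣ tail f ∣
  split f = ∣x∷p∣≡indicator[x]+∣p∣ (f Fin.zero) (tail f)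
  tails : ∣ tail f ∣ + ∣ tail g ∣ ≡ ∣ tail h ∣ + ∣ tail k ∣
  tails = ∣tabulate∣-+-pointwise (f ∘ Fin.suc) (g ∘ Fin.suc) (h ∘ Fin.suc) (k ∘ Fin.suc) (pointwise ∘ Fin.suc)

∈-tabulate⁺ : ∀ {N} {f : Fin N → Bool} {i} → T (f i) → i ∈ₛ tabulate f
∈-tabulate⁺ {f = f} {i} fi = lookup⇒[]= i _ (trans (lookup∘tabulate f i) (Equivalence.to T-≡ fi))

∈-tabulate⁻ : ∀ {N} {f : Fin N → Bool} {i} → i ∈ₛ tabulate f → T (f i)
∈-tabulate⁻ {f = f} {i} i∈ = Equivalence.from T-≡ (trans (sym (lookup∘tabulate f i)) ([]=⇒lookup i∈))

⌊⌋-⇔ : ∀ {A B : Set} → A ⇔ B → (a? : Dec A) (b? : Dec B) → ⌊ a? ⌋ ≡ ⌊ b? ⌋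
⌊⌋-⇔ A⇔B a? b? = trans (isYes≗does a?) (trans (does-⇔ A⇔B a? b?) (sym (isYes≗does b?)))

inInterval : ℕ → ℕ → ℕ → Bool
inInterval lo hi x = ⌊ lo ≤? x ×-dec x <? hi ⌋

indicator-inInterval-modular : ∀ {L₀ L H N} x → L₀ ≤ L → L ≤ H → H ≤ N →
  indicator (inInterval L H x) + indicator (inInterval L₀ N x)
    ≡ indicator (inInterval L₀ H x) + indicator (inInterval L N x)
indicator-inInterval-modular {L₀} {L} {H} {N} x L₀≤L L≤H H≤N
  with L₀ ≤? x | L ≤? x | x <? H | x <? N
... | no L₀≰x | yes L≤x | _       | _       = contradiction (≤-trans L₀≤L L≤x) L₀≰x
... | _       | _       | yes x<H | no x≮N  = contradiction (<-≤-trans x<H H≤N) x≮N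
... | yes _   | no L≰x  | no x≮H  | _       = contradiction (<-≤-trans (≰⇒> L≰x) L≤H) x≮H
... | yes _   | yes _   | yes _   | yes _   = refl
... | yes _   | yes _   | no _    | yes _   = refl
... | yes _   | yes _   | no _    | no _    = refl
... | yes _   | no _    | yes _   | yes _   = refl
... | no _    | no _    | yes _   | yes _   = refl
... | no _    | no _    | no _    | _       = refl

∈-replace : ∀ xs {x c c' : ℕ} {ys} → x ≢ c → x ∈ xs ++ c ∷ ys → x ∈ xs ++ c' ∷ ys
∈-replace xs x≢c x∈ with ∈-++⁻ xs x∈
... | inj₁ x∈xs               = ∈-++⁺ˡ x∈xs
... | inj₂ (here x≡c)         = contradiction x≡c x≢c
... | inj₂ (there x∈ys)       = ∈-++⁺ʳ xs (there x∈ys)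

∈-replace-⇔ : ∀ xs {x c c' : ℕ} {ys} → x ≢ c → x ≢ c' → x ∈ xs ++ c ∷ ys ⇔ x ∈ xs ++ c' ∷ ys
∈-replace-⇔ xs x≢c x≢c' = mk⇔ (∈-replace xs x≢c) (∈-replace xs x≢c')

segment : ℕ → ℕ → List ℕ
segment lo hi = applyUpTo (λ i → lo + i) (suc (hi ∸ lo))

∈-segment⁺ : ∀ {lo hi s} → lo ≤ s → s ≤ hi → s ∈ segment lo hi
∈-segment⁺ {lo} {hi} lo≤s s≤hi =
  subst (_∈ segment lo hi) (m+[n∸m]≡n lo≤s) (∈-applyUpTo⁺ (λ i → lo + i) (s≤s (∸-monoˡ-≤ lo s≤hi)))

∈-segment⁻ : ∀ {lo hi s} → lo ≤ hi → s ∈ segment lo hi → lo ≤ s × s ≤ hi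
∈-segment⁻ {lo} lo≤hi s∈ with ∈-applyUpTo⁻ (λ i → lo + i) s∈
... | i , i<1+hi-lo , refl =
  m≤m+n lo i , ≤-trans (+-monoʳ-≤ lo (s≤s⁻¹ i<1+hi-lo)) (≤-reflexive (m+[n∸m]≡n lo≤hi))

w+y≡x+z⇒+w≡+x-+y+z : ∀ {w x y z} → w + y ≡ x + z → + w ≡ (+ x - + y) +ℤ + z
w+y≡x+z⇒+w≡+x-+y+z {w} {x} {y} {z} eq = sym (begin
  (+ x - + y) +ℤ + z   ≡⟨ swap-minus (+ x) (+ y) (+ z) ⟩
  (+ x +ℤ + z) - + y   ≡⟨ cong (_- + y) (pos-+ x z) ⟨
  + (x + z) - + y      ≡⟨ cong (λ s → + s - + y) eq ⟨
  + (w + y) - + y      ≡⟨ cong (_- + y) (pos-+ w y) ⟩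
  (+ w +ℤ + y) - + y   ≡⟨ add-sub-cancel (+ w) (+ y) ⟩
  + w                  ∎)
  where
  swap-minus : ∀ (a b c : ℤ) → (a - b) +ℤ c ≡ (a +ℤ c) - b
  swap-minus = solve-∀
  add-sub-cancel : ∀ (a b : ℤ) → (a +ℤ b) - b ≡ a
  add-sub-cancel = solve-∀

module CaterpillarSteiner (G : Caterpillar) where
  open Caterpillar G

  _++ʷ_ : ∀ {F u v w} → Walk G F u v → Walk G F v w → Walk G F u w
  [] ++ʷ q = q
  (s ∷ p) ++ʷ q = s ∷ (p ++ʷ q)

  Joins-sym : ∀ {e u w} → Joins G e u w → Joins G e w u
  Joins-sym (inj₁ (p , q)) = inj₂ (p , q)
  Joins-sym (inj₂ (p , q)) = inj₁ (p , q)

  reverseʷ : ∀ {F u v} → Walk G F u v → Walk G F v u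
  reverseʷ [] = []
  reverseʷ ((e , e∈F , J) ∷ p) = reverseʷ p ++ʷ ((e , e∈F , Joins-sym J) ∷ [])

  pendant : Fin m → ℕ
  pendant p = suc (n + toℕ p)

  n<pendant : ∀ p → n < pendant p
  n<pendant p = s≤s (m≤m+n n (toℕ p))

  pendant≤n+m : ∀ p → pendant p ≤ n + m
  pendant≤n+m p = subst (_≤ n + m) (+-suc n (toℕ p)) (+-monoʳ-≤ n (toℕ<n p))

  pendant-injective : ∀ {p q} → pendant p ≡ pendant q → p ≡ q
  pendant-injective = toℕ-injective ∘ +-cancelˡ-≡ n _ _ ∘ suc-injective

  pendant≢ : ∀ p {v} → v ≤ n → pendant p ≢ v
  pendant≢ p v≤n refl = <⇒≱ (n<pendant p) v≤n

  data VertexView (v : ℕ) : Set where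
    pathVertex    : v ≤ n → VertexView v
    pendantVertex : (p : Fin m) → v ≡ pendant p → VertexView v
    nonVertex     : n + m < v → VertexView v

  vertexView : ∀ v → VertexView v
  vertexView v with v ≤? n
  ... | yes v≤n = pathVertex v≤n
  ... | no v≰n with v ∸ suc n <? m
  ...   | yes d<m = pendantVertex (fromℕ< d<m) (begin
          v                          ≡⟨ m+[n∸m]≡n (≰⇒> v≰n) ⟨
          suc n + (v ∸ suc n)        ≡⟨ cong (λ d → suc (n + d)) (toℕ-fromℕ< d<m) ⟨
          pendant (fromℕ< d<m)       ∎)
  ...   | no d≮m = nonVertex (≤-trans (s≤s (+-monoʳ-≤ n (≮⇒≥ d≮m)))
                                       (≤-reflexive (m+[n∸m]≡n (≰⇒> v≰n))))

  -- the path vertex nearest to v; the value 0 off the vertex set is junk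
  foot : ℕ → ℕ
  foot v with vertexView v
  ... | pathVertex _      = v
  ... | pendantVertex p _ = att p
  ... | nonVertex _       = 0

  foot≤n : ∀ v → foot v ≤ n
  foot≤n v with vertexView v
  ... | pathVertex v≤n    = v≤n
  ... | pendantVertex p _ = att≤n p
  ... | nonVertex _       = z≤n

  foot-path : ∀ {v} → v ≤ n → foot v ≡ v
  foot-path {v} v≤n with vertexView v
  ... | pathVertex _         = refl
  ... | pendantVertex p refl = contradiction refl (pendant≢ p v≤n)
  ... | nonVertex n+m<v      = contradiction (≤-trans v≤n (m≤m+n n m)) (<⇒≱ n+m<v)

  foot-pendant : ∀ p → foot (pendant p) ≡ att p
  foot-pendant p with vertexView (pendant p)
  ... | pathVertex p≤n       = contradiction p≤n (<⇒≱ (n<pendant p))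
  ... | pendantVertex q p≡q  = cong att (pendant-injective (sym p≡q))
  ... | nonVertex n+m<p      = contradiction (pendant≤n+m p) (<⇒≱ n+m<p)

  data EdgeView : Edge G → Set where
    pathEdge    : (t : Fin n) → EdgeView (t ↑ˡ m)
    pendantEdge : (p : Fin m) → EdgeView (n ↑ʳ p)

  edgeView : ∀ e → EdgeView e
  edgeView e with splitAt n e in eq
  ... | inj₁ t = subst EdgeView (splitAt⁻¹-↑ˡ eq) (pathEdge t)
  ... | inj₂ p = subst EdgeView (splitAt⁻¹-↑ʳ eq) (pendantEdge p)

  ends-pathEdge : ∀ t → ends G (t ↑ˡ m) ≡ (toℕ t , suc (toℕ t))
  ends-pathEdge t rewrite splitAt-↑ˡ n t m = refl

  ends-pendantEdge : ∀ p → ends G (n ↑ʳ p) ≡ (att p , pendant p)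
  ends-pendantEdge p rewrite splitAt-↑ʳ n m p = refl

  Joins-ends : ∀ {e x y u w} → ends G e ≡ (x , y) → Joins G e u w →
               (u ≡ x × w ≡ y) ⊎ (u ≡ y × w ≡ x)
  Joins-ends refl (inj₁ (x≡u , y≡w)) = inj₁ (sym x≡u , sym y≡w)
  Joins-ends refl (inj₂ (x≡w , y≡u)) = inj₂ (sym y≡u , sym x≡w)

  Joins-pathEdge : ∀ {s} (s<n : s < n) → Joins G (fromℕ< s<n ↑ˡ m) (suc s) s
  Joins-pathEdge s<n rewrite ends-pathEdge (fromℕ< s<n) | toℕ-fromℕ< s<n = inj₂ (refl , refl)

  Joins-pendantEdge : ∀ p → Joins G (n ↑ʳ p) (pendant p) (att p)
  Joins-pendantEdge p rewrite ends-pendantEdge p = inj₂ (refl , refl)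

  Joins-above-n : ∀ {e u w} → n < u → Joins G e u w →
                  ∃ λ p → e ≡ n ↑ʳ p × u ≡ pendant p × w ≡ att p
  Joins-above-n {e} n<u J with edgeView e
  ... | pathEdge t with Joins-ends (ends-pathEdge t) J
  ...   | inj₁ (refl , _) = contradiction (<⇒≤ (toℕ<n t)) (<⇒≱ n<u)
  ...   | inj₂ (refl , _) = contradiction (toℕ<n t) (<⇒≱ n<u)
  Joins-above-n n<u J | pendantEdge p with Joins-ends (ends-pendantEdge p) J
  ...   | inj₁ (refl , _)   = contradiction (att≤n p) (<⇒≱ n<u)
  ...   | inj₂ (u≡p , w≡a)  = p , refl , u≡p , w≡a

  foot-Adj-pendant : ∀ {u w} → n < u → Adj G u w → foot u ≡ w
  foot-Adj-pendant n<u (e , J) with Joins-above-n n<u J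
  ... | p , _ , refl , refl = foot-pendant p

  -- Only path edge t can carry a walk from feet ≤ t to feet > t.
  foot-Joins-≤ : ∀ {e u w} t → Joins G e u w → e ≢ t ↑ˡ m → foot u ≤ toℕ t → foot w ≤ toℕ t
  foot-Joins-≤ {e} t J e≢t fu≤t with edgeView e
  ... | pendantEdge p with Joins-ends (ends-pendantEdge p) J
  ...   | inj₁ (refl , refl) rewrite foot-path (att≤n p) | foot-pendant p = fu≤t
  ...   | inj₂ (refl , refl) rewrite foot-path (att≤n p) | foot-pendant p = fu≤t
  foot-Joins-≤ t J e≢t fu≤t | pathEdge s with Joins-ends (ends-pathEdge s) J
  ...   | inj₁ (refl , refl) rewrite foot-path (<⇒≤ (toℕ<n s)) | foot-path (toℕ<n s) =
    ≤∧≢⇒< fu≤t (e≢t ∘ cong (_↑ˡ m) ∘ toℕ-injective)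
  ...   | inj₂ (refl , refl) rewrite foot-path (<⇒≤ (toℕ<n s)) | foot-path (toℕ<n s) =
    ≤-trans (n≤1+n _) fu≤t

  walk-crosses-pathEdge : ∀ {F u v} t → Walk G F u v → foot u ≤ toℕ t → toℕ t < foot v →
                          t ↑ˡ m ∈ₛ F
  walk-crosses-pathEdge t [] fu≤t t<fv = contradiction fu≤t (<⇒≱ t<fv)
  walk-crosses-pathEdge t ((e , e∈F , J) ∷ walk) fu≤t t<fv with e Fin.≟ t ↑ˡ m
  ... | yes refl = e∈F
  ... | no e≢t   = walk-crosses-pathEdge t walk (foot-Joins-≤ t J e≢t fu≤t) t<fv

  walk-leaves-pendant : ∀ {F w} p → Walk G F (pendant p) w → pendant p ≢ w → n ↑ʳ p ∈ₛ F
  walk-leaves-pendant p [] p≢w = contradiction refl p≢w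
  walk-leaves-pendant {F} p ((e , e∈F , J) ∷ _) _ with Joins-above-n (n<pendant p) J
  ... | q , refl , p≡q , _ = subst (λ r → n ↑ʳ r ∈ₛ F) (sym (pendant-injective p≡q)) e∈F

  minFoot maxFoot : List ℕ → ℕ
  minFoot = foldr (λ y → foot y ⊓_) n
  maxFoot = foldr (λ y → foot y ⊔_) 0

  minFoot≤foot : ∀ {y Y} → y ∈ Y → minFoot Y ≤ foot y
  minFoot≤foot (here refl) = m⊓n≤m _ _
  minFoot≤foot {Y = x ∷ _} (there y∈Y) = ≤-trans (m⊓n≤n (foot x) _) (minFoot≤foot y∈Y)

  foot≤maxFoot : ∀ {y Y} → y ∈ Y → foot y ≤ maxFoot Y
  foot≤maxFoot (here refl) = m≤m⊔n _ _
  foot≤maxFoot {Y = x ∷ _} (there y∈Y) = ≤-trans (foot≤maxFoot y∈Y) (m≤n⊔m (foot x) _)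

  maxFoot≤n : ∀ Y → maxFoot Y ≤ n
  maxFoot≤n []      = z≤n
  maxFoot≤n (y ∷ Y) = ⊔-lub (foot≤n y) (maxFoot≤n Y)

  minFoot≤⇒∃foot≤ : ∀ Y {x} → minFoot Y ≤ x → x < n → ∃ λ y → y ∈ Y × foot y ≤ x
  minFoot≤⇒∃foot≤ []      n≤x x<n = contradiction n≤x (<⇒≱ x<n)
  minFoot≤⇒∃foot≤ (y ∷ Y) min≤x x<n with ⊓-sel (foot y) (minFoot Y)
  ... | inj₁ min≡fy = y , here refl , subst (_≤ _) min≡fy min≤x
  ... | inj₂ min≡mY with minFoot≤⇒∃foot≤ Y (subst (_≤ _) min≡mY min≤x) x<n
  ...   | z , z∈Y , fz≤x = z , there z∈Y , fz≤x

  <maxFoot⇒∃<foot : ∀ Y {x} → x < maxFoot Y → ∃ λ y → y ∈ Y × x < foot y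
  <maxFoot⇒∃<foot []      ()
  <maxFoot⇒∃<foot (y ∷ Y) x<max with ⊔-sel (foot y) (maxFoot Y)
  ... | inj₁ max≡fy = y , here refl , subst (_ <_) max≡fy x<max
  ... | inj₂ max≡mY with <maxFoot⇒∃<foot Y (subst (_ <_) max≡mY x<max)
  ...   | z , z∈Y , x<fz = z , there z∈Y , x<fz

  minFoot-++ : ∀ xs ys zs → minFoot ys ≡ minFoot zs → minFoot (xs ++ ys) ≡ minFoot (xs ++ zs)
  minFoot-++ []       _  _  eq = eq
  minFoot-++ (x ∷ xs) ys zs eq = cong (foot x ⊓_) (minFoot-++ xs ys zs eq)

  maxFoot-++ : ∀ xs ys zs → maxFoot ys ≡ maxFoot zs → maxFoot (xs ++ ys) ≡ maxFoot (xs ++ zs)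
  maxFoot-++ []       _  _  eq = eq
  maxFoot-++ (x ∷ xs) ys zs eq = cong (foot x ⊔_) (maxFoot-++ xs ys zs eq)

  minFoot-pair : ∀ x y → foot x ≤ foot y → minFoot (x ∷ y ∷ []) ≡ foot x
  minFoot-pair x y fx≤fy = begin
    foot x ⊓ (foot y ⊓ n)  ≡⟨ cong (foot x ⊓_) (m≤n⇒m⊓n≡m (foot≤n y)) ⟩
    foot x ⊓ foot y        ≡⟨ m≤n⇒m⊓n≡m fx≤fy ⟩
    foot x                 ∎

  maxFoot-pair : ∀ x y → foot x ≤ foot y → maxFoot (x ∷ y ∷ []) ≡ foot y
  maxFoot-pair x y fx≤fy = begin
    foot x ⊔ (foot y ⊔ 0)  ≡⟨ cong (foot x ⊔_) (⊔-identityʳ (foot y)) ⟩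
    foot x ⊔ foot y        ≡⟨ m≤n⇒m⊔n≡n fx≤fy ⟩
    foot y                 ∎

  spanIndicator : ℕ → ℕ → List ℕ → Edge G → Bool
  spanIndicator lo hi Y e =
    [ (λ t → inInterval lo hi (toℕ t)) , (λ p → ⌊ pendant p ∈? Y ⌋) ] (splitAt n e)

  spanEdges : ℕ → ℕ → List ℕ → Subset (n + m)
  spanEdges lo hi Y = tabulate (spanIndicator lo hi Y)

  steinerEdges : List ℕ → Subset (n + m)
  steinerEdges Y = spanEdges (minFoot Y) (maxFoot Y) Y

  spanIndicator-pathEdge : ∀ {lo hi Y} t → spanIndicator lo hi Y (t ↑ˡ m) ≡ inInterval lo hi (toℕ t)
  spanIndicator-pathEdge t rewrite splitAt-↑ˡ n t m = refl

  spanIndicator-pendantEdge : ∀ {lo hi Y} p → spanIndicator lo hi Y (n ↑ʳ p) ≡ ⌊ pendant p ∈? Y ⌋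
  spanIndicator-pendantEdge p rewrite splitAt-↑ʳ n m p = refl

  ∈-spanEdges-path⁺ : ∀ {lo hi Y} t → lo ≤ toℕ t → toℕ t < hi → t ↑ˡ m ∈ₛ spanEdges lo hi Y
  ∈-spanEdges-path⁺ t lo≤t t<hi =
    ∈-tabulate⁺ (subst T (sym (spanIndicator-pathEdge t)) (fromWitness (lo≤t , t<hi)))

  ∈-spanEdges-path⁻ : ∀ {lo hi Y} t → t ↑ˡ m ∈ₛ spanEdges lo hi Y → lo ≤ toℕ t × toℕ t < hi
  ∈-spanEdges-path⁻ {lo} {hi} t t∈ =
    toWitness {a? = lo ≤? toℕ t ×-dec toℕ t <? hi} (subst T (spanIndicator-pathEdge t) (∈-tabulate⁻ t∈))

  ∈-spanEdges-pendant⁺ : ∀ {lo hi Y} p → pendant p ∈ Y → n ↑ʳ p ∈ₛ spanEdges lo hi Y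
  ∈-spanEdges-pendant⁺ p p∈Y =
    ∈-tabulate⁺ (subst T (sym (spanIndicator-pendantEdge p)) (fromWitness p∈Y))

  ∈-spanEdges-pendant⁻ : ∀ {lo hi Y} p → n ↑ʳ p ∈ₛ spanEdges lo hi Y → pendant p ∈ Y
  ∈-spanEdges-pendant⁻ {Y = Y} p p∈ =
    toWitness {a? = pendant p ∈? Y} (subst T (spanIndicator-pendantEdge p) (∈-tabulate⁻ p∈))

  ∣spanEdges∣-modular : ∀ {L₀ L H N Y₁ Y₂ Y₃ Y₄} → L₀ ≤ L → L ≤ H → H ≤ N →
    (∀ p → pendant p ∈ Y₁ ⇔ pendant p ∈ Y₂) → (∀ p → pendant p ∈ Y₃ ⇔ pendant p ∈ Y₄) →
    ∣ spanEdges L H Y₁ ∣ + ∣ spanEdges L₀ N Y₃ ∣ ≡ ∣ spanEdges L₀ H Y₂ ∣ + ∣ spanEdges L N Y₄ ∣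
  ∣spanEdges∣-modular {L₀} {L} {H} {N} {Y₁} {Y₂} {Y₃} {Y₄} L₀≤L L≤H H≤N Y₁⇔Y₂ Y₃⇔Y₄ =
    ∣tabulate∣-+-pointwise _ _ _ _ pointwise
    where
    pointwise : ∀ e → indicator (spanIndicator L H Y₁ e) + indicator (spanIndicator L₀ N Y₃ e)
                    ≡ indicator (spanIndicator L₀ H Y₂ e) + indicator (spanIndicator L N Y₄ e)
    pointwise e with splitAt n e
    ... | inj₁ t = indicator-inInterval-modular (toℕ t) L₀≤L L≤H H≤N
    ... | inj₂ p = cong₂ _+_ (cong indicator (⌊⌋-⇔ (Y₁⇔Y₂ p) (pendant p ∈? Y₁) (pendant p ∈? Y₂)))
                             (cong indicator (⌊⌋-⇔ (Y₃⇔Y₄ p) (pendant p ∈? Y₃) (pendant p ∈? Y₄)))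

  steinerEdges⊆ : ∀ {Y u v} → u ∈ Y → v ∈ Y → u ≢ v →
    (H : ConnSubgraph G) → Contains G H Y → steinerEdges Y ⊆ ConnSubgraph.F H
  steinerEdges⊆ {Y} u∈Y v∈Y u≢v H Y⊆H {e} e∈ with edgeView e
  ... | pathEdge t with ∈-spanEdges-path⁻ t e∈
  ...   | lo≤t , t<hi with minFoot≤⇒∃foot≤ Y lo≤t (toℕ<n t) | <maxFoot⇒∃<foot Y t<hi
  ...     | x , x∈Y , fx≤t | z , z∈Y , t<fz =
    walk-crosses-pathEdge t (ConnSubgraph.conn H (All.lookup Y⊆H x∈Y) (All.lookup Y⊆H z∈Y)) fx≤t t<fz
  steinerEdges⊆ {Y} {u} u∈Y v∈Y u≢v H Y⊆H e∈ | pendantEdge p with pendant p Data.Nat.≟ u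
  ... | yes refl = walk-leaves-pendant p (ConnSubgraph.conn H (All.lookup Y⊆H u∈Y) (All.lookup Y⊆H v∈Y)) u≢v
  ... | no p≢u   = walk-leaves-pendant p
        (ConnSubgraph.conn H (All.lookup Y⊆H (∈-spanEdges-pendant⁻ p e∈)) (All.lookup Y⊆H u∈Y)) p≢u

  module SteinerTree (Y : List ℕ) {y₀} (y₀∈Y : y₀ ∈ Y) (Y-vertices : All (IsVertex G) Y) where
    lo hi : ℕ
    lo = minFoot Y
    hi = maxFoot Y

    lo≤hi : lo ≤ hi
    lo≤hi = ≤-trans (minFoot≤foot y₀∈Y) (foot≤maxFoot y₀∈Y)

    lo≤foot≤hi : ∀ {y} → y ∈ Y → lo ≤ foot y × foot y ≤ hi
    lo≤foot≤hi y∈Y = minFoot≤foot y∈Y , foot≤maxFoot y∈Y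

    vertices : List ℕ
    vertices = Y ++ segment lo hi

    descend : ∀ {s} → lo ≤ s → s ≤ hi → Walk G (steinerEdges Y) s lo
    descend {s} lo≤s s≤hi with m≤n⇒m<n∨m≡n lo≤s
    ... | inj₂ refl = []
    descend {suc s} _ s<hi | inj₁ lo<1+s = step ∷ descend (s≤s⁻¹ lo<1+s) (<⇒≤ s<hi)
      where
      s<n : s < n
      s<n = <-≤-trans s<hi (maxFoot≤n Y)
      t≡s : toℕ (fromℕ< s<n) ≡ s
      t≡s = toℕ-fromℕ< s<n
      step : ∃ λ e → e ∈ₛ steinerEdges Y × Joins G e (suc s) s
      step = fromℕ< s<n ↑ˡ m
           , ∈-spanEdges-path⁺ _ (subst (lo ≤_) (sym t≡s) (s≤s⁻¹ lo<1+s)) (subst (_< hi) (sym t≡s) s<hi)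
           , Joins-pathEdge s<n

    descendFrom : ∀ {y} → y ∈ Y → Walk G (steinerEdges Y) y lo
    -- abstracting vertexView y also unfolds foot y in the bounds on it
    descendFrom {y} y∈Y with vertexView y | lo≤foot≤hi y∈Y
    ... | pathVertex _ | lo≤fy , fy≤hi = descend lo≤fy fy≤hi
    ... | pendantVertex p refl | lo≤fy , fy≤hi =
      (n ↑ʳ p , ∈-spanEdges-pendant⁺ p y∈Y , Joins-pendantEdge p) ∷ descend lo≤fy fy≤hi
    ... | nonVertex n+m<y | _ = contradiction (All.lookup Y-vertices y∈Y) (<⇒≱ n+m<y)

    descendFromVertex : ∀ {x} → x ∈ vertices → Walk G (steinerEdges Y) x lo
    descendFromVertex x∈ with ∈-++⁻ Y x∈
    ... | inj₁ x∈Y   = descendFrom x∈Y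
    ... | inj₂ x∈seg = let lo≤x , x≤hi = ∈-segment⁻ lo≤hi x∈seg in descend lo≤x x≤hi

    vertices-valid : ∀ {x} → x ∈ vertices → IsVertex G x
    vertices-valid x∈ with ∈-++⁻ Y x∈
    ... | inj₁ x∈Y   = All.lookup Y-vertices x∈Y
    ... | inj₂ x∈seg = ≤-trans (proj₂ (∈-segment⁻ lo≤hi x∈seg)) (≤-trans (maxFoot≤n Y) (m≤m+n n m))

    edge-ends : ∀ e → e ∈ₛ steinerEdges Y →
                proj₁ (ends G e) ∈ vertices × proj₂ (ends G e) ∈ vertices
    edge-ends e e∈ with edgeView e
    ... | pathEdge t rewrite ends-pathEdge t =
      let lo≤t , t<hi = ∈-spanEdges-path⁻ t e∈
      in ∈-++⁺ʳ Y (∈-segment⁺ lo≤t (<⇒≤ t<hi)) , ∈-++⁺ʳ Y (∈-segment⁺ (≤-trans lo≤t (n≤1+n _)) t<hi)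
    ... | pendantEdge p rewrite ends-pendantEdge p =
      let p∈Y = ∈-spanEdges-pendant⁻ p e∈
          lo≤a , a≤hi = lo≤foot≤hi p∈Y
      in ∈-++⁺ʳ Y (∈-segment⁺ (subst (lo ≤_) (foot-pendant p) lo≤a) (subst (_≤ hi) (foot-pendant p) a≤hi))
       , ∈-++⁺ˡ p∈Y

    steinerTree : ConnSubgraph G
    steinerTree = record
      { S      = vertices
      ; F      = steinerEdges Y
      ; S-vert = All.tabulate vertices-valid
      ; F-ends = edge-ends
      ; conn   = λ u∈ v∈ → descendFromVertex u∈ ++ʷ reverseʷ (descendFromVertex v∈)
      }

    steinerTree-contains : Contains G steinerTree Y
    steinerTree-contains = All.tabulate ∈-++⁺ˡ

  steinerDistance≡∣steinerEdges∣ : ∀ {Y u v d} → u ∈ Y → v ∈ Y → u ≢ v → All (IsVertex G) Y →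
    IsSteinerDist G Y d → d ≡ ∣ steinerEdges Y ∣
  steinerDistance≡∣steinerEdges∣ {Y} u∈Y v∈Y u≢v Y-vertices ((H , Y⊆H , size≡d) , minimal) =
    ≤-antisym (minimal steinerTree steinerTree-contains)
              (subst (∣ steinerEdges Y ∣ ≤_) size≡d (p⊆q⇒∣p∣≤∣q∣ (steinerEdges⊆ u∈Y v∈Y u≢v H Y⊆H)))
    where open SteinerTree Y u∈Y Y-vertices

  ∣steinerEdges∣-column : ∀ a b {k j} → k ≤ n → k ≤ foot j →
    ∣ steinerEdges (a ∷ b ∷ k ∷ j ∷ []) ∣ + ∣ steinerEdges (a ∷ b ∷ 0 ∷ n ∷ []) ∣
      ≡ ∣ steinerEdges (a ∷ b ∷ 0 ∷ j ∷ []) ∣ + ∣ steinerEdges (a ∷ b ∷ k ∷ n ∷ []) ∣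
  ∣steinerEdges∣-column a b {k} {j} k≤n k≤fj = begin
    ∣ steinerEdges Y₁ ∣ + ∣ steinerEdges Y₃ ∣
      ≡⟨ ∣spanEdges∣-modular L₀≤L L≤H H≤N
           (λ p → ∈-replace-⇔ (a ∷ b ∷ []) (pendant≢ p k≤n) (pendant≢ p z≤n))
           (λ p → ∈-replace-⇔ (a ∷ b ∷ []) (pendant≢ p z≤n) (pendant≢ p k≤n)) ⟩
    ∣ spanEdges L₀ H Y₂ ∣ + ∣ spanEdges L N Y₄ ∣
      ≡⟨ cong₂ _+_ (cong₂ (λ l h → ∣ spanEdges l h Y₂ ∣) min₂ max₂)
                   (cong₂ (λ l h → ∣ spanEdges l h Y₄ ∣) min₄ max₄) ⟨
    ∣ steinerEdges Y₂ ∣ + ∣ steinerEdges Y₄ ∣ ∎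
    where
    Y₁ Y₂ Y₃ Y₄ : List ℕ
    Y₁ = a ∷ b ∷ k ∷ j ∷ []
    Y₂ = a ∷ b ∷ 0 ∷ j ∷ []
    Y₃ = a ∷ b ∷ 0 ∷ n ∷ []
    Y₄ = a ∷ b ∷ k ∷ n ∷ []
    L H L₀ N : ℕ
    L  = minFoot Y₁
    H  = maxFoot Y₁
    L₀ = minFoot Y₃
    N  = maxFoot Y₃
    f0≡0 : foot 0 ≡ 0
    f0≡0 = foot-path z≤n
    fn≡n : foot n ≡ n
    fn≡n = foot-path ≤-refl
    fk≤fj : foot k ≤ foot j
    fk≤fj = subst (_≤ foot j) (sym (foot-path k≤n)) k≤fj
    fk≤fn : foot k ≤ foot n
    fk≤fn = subst₂ _≤_ (sym (foot-path k≤n)) (sym fn≡n) k≤n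
    f0≤ : ∀ x → foot 0 ≤ foot x
    f0≤ x = subst (_≤ foot x) (sym f0≡0) z≤n
    min₂ : minFoot Y₂ ≡ L₀
    min₂ = minFoot-++ (a ∷ b ∷ []) (0 ∷ j ∷ []) (0 ∷ n ∷ [])
             (trans (minFoot-pair 0 j (f0≤ j)) (sym (minFoot-pair 0 n (f0≤ n))))
    max₂ : maxFoot Y₂ ≡ H
    max₂ = maxFoot-++ (a ∷ b ∷ []) (0 ∷ j ∷ []) (k ∷ j ∷ [])
             (trans (maxFoot-pair 0 j (f0≤ j)) (sym (maxFoot-pair k j fk≤fj)))
    min₄ : minFoot Y₄ ≡ L
    min₄ = minFoot-++ (a ∷ b ∷ []) (k ∷ n ∷ []) (k ∷ j ∷ [])
             (trans (minFoot-pair k n fk≤fn) (sym (minFoot-pair k j fk≤fj)))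
    max₄ : maxFoot Y₄ ≡ N
    max₄ = maxFoot-++ (a ∷ b ∷ []) (k ∷ n ∷ []) (0 ∷ n ∷ [])
             (trans (maxFoot-pair k n fk≤fn) (sym (maxFoot-pair 0 n (f0≤ n))))
    L₀≤L : L₀ ≤ L
    L₀≤L = ≤-trans (minFoot≤foot {Y = Y₃} (there (there (here refl)))) (subst (_≤ L) (sym f0≡0) z≤n)
    L≤H : L ≤ H
    L≤H = ≤-trans (minFoot≤foot {Y = Y₁} (here refl)) (foot≤maxFoot {Y = Y₁} (here refl))
    H≤N : H ≤ N
    H≤N = ≤-trans (maxFoot≤n Y₁)
                  (subst (_≤ N) fn≡n (foot≤maxFoot {Y = Y₃} (there (there (there (here refl))))))

mainTheorem8 : (G : Caterpillar) → MaxPath G →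
    let n = Caterpillar.n G in
    let m = Caterpillar.m G in
    (k j i : ℕ) → 0 < k → k ≤ n → n < j → j ≤ n + m →
    i ≤ n → Adj G j i → ¬ InX G k j → k < i →
    (a b : ℕ) → a ≤ n + m → b ≤ n + m → ¬ a ≡ b →
    (d₁ d₂ d₃ d₄ : ℕ) →
    IsSteinerDist G (a ∷ b ∷ k ∷ j ∷ []) d₁ →
    IsSteinerDist G (a ∷ b ∷ 0 ∷ j ∷ []) d₂ →
    IsSteinerDist G (a ∷ b ∷ 0 ∷ n ∷ []) d₃ →
    IsSteinerDist G (a ∷ b ∷ k ∷ n ∷ []) d₄ →
    + d₁ ≡ (+ d₂ - + d₃) +ℤ + d₄
mainTheorem8 G _ k j i _ k≤n n<j j≤n+m _ j~i _ k<i a b a≤n+m b≤n+m a≢b d₁ d₂ d₃ d₄ s₁ s₂ s₃ s₄ =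
  w+y≡x+z⇒+w≡+x-+y+z (begin
    d₁ + d₃
      ≡⟨ cong₂ _+_ (distance k≤n+m j≤n+m s₁) (distance z≤n n≤n+m s₃) ⟩
    ∣ steinerEdges (a ∷ b ∷ k ∷ j ∷ []) ∣ + ∣ steinerEdges (a ∷ b ∷ 0 ∷ n ∷ []) ∣
      ≡⟨ ∣steinerEdges∣-column a b k≤n (subst (k ≤_) (sym (foot-Adj-pendant n<j j~i)) (<⇒≤ k<i)) ⟩
    ∣ steinerEdges (a ∷ b ∷ 0 ∷ j ∷ []) ∣ + ∣ steinerEdges (a ∷ b ∷ k ∷ n ∷ []) ∣
      ≡⟨ cong₂ _+_ (distance z≤n j≤n+m s₂) (distance k≤n+m n≤n+m s₄) ⟨
    d₂ + d₄ ∎)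
  where
  open Caterpillar G
  open CaterpillarSteiner G
  n≤n+m : n ≤ n + m
  n≤n+m = m≤m+n n m
  k≤n+m : k ≤ n + m
  k≤n+m = ≤-trans k≤n n≤n+m
  distance : ∀ {c d δ} → c ≤ n + m → d ≤ n + m → IsSteinerDist G (a ∷ b ∷ c ∷ d ∷ []) δ →
             δ ≡ ∣ steinerEdges (a ∷ b ∷ c ∷ d ∷ []) ∣
  distance c≤ d≤ = steinerDistance≡∣steinerEdges∣ (here refl) (there (here refl)) a≢b
                     (a≤n+m All.∷ b≤n+m All.∷ c≤ All.∷ d≤ All.∷ All.[])
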